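{- Let $S$ be a Boolean sublattice and let $\mathcal{A}_I(S)$ be its set of isolated quarks. Then $S$ is an LFS if and only if $\langle\mathcal{A}(S)\setminus\mathcal{A}_I(S)\rangle$ is an LFS.
   Context: Let $B_{\mathbb{N}}$ be the set of all finite subsets of $\mathbb{N}=\{1,2,3,\dots\}$, ordered by inclusion. A Boolean sublattice is a subset $S\subseteq B_{\mathbb{N}}$ containing $\emptyset$ and closed under finite unions. For a collection $T$ of finite subsets of $\mathbb{N}$, $\langle T\rangle$ denotes the smallest Boolean sublattice containing $T$. A quark of $S$ is a nonempty $A\in S$ such that no $B\in S$ satisfies $\emptyset\subsetneq B\subsetneq A$; $\mathcal{A}(S)$ is the set of quarks. A quark is isolated if it is disjoint from every other quark of $S$. For nonempty $X\in S$, a factorization of $X$ in $S$ is a finite set $z\subseteq\mathcal{A}(S)$ with $\bigcup z=X$ and $\bigcup z'\subsetneq X$ for every proper subset $z'\subsetneq z$. $S$ is an LFS (length-factorial) if any two distinct factorizations of the same nonempty element of $S$ have different sizes. -}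

module Defs where

open import Level using (Level) renaming (suc to lsuc)
open import Data.Nat using (ℕ)
open import Data.Empty using (⊥)
open import Data.List using (List; []; _++_; concat; length)
open import Data.List.Membership.Propositional using (_∈_)
open import Data.List.Relation.Unary.All using (All)
open import Data.List.Relation.Unary.Any using (Any)
open import Data.List.Relation.Unary.AllPairs using (AllPairs)
open import Data.Product using (Σ; ∃; _×_)
open import Relation.Nullary using (¬_)
open import Relation.Binary.PropositionalEquality using (_≢_)

-- A finite subset of ℕ = {1,2,3,...}.  It is represented by a list of
-- natural numbers, where the Agda natural number n encodes the element
-- n + 1 (a bijection ℕ_Agda ≅ {1,2,...}); sets are compared extensionally.
FinSet : Set
FinSet = List ℕ

_⊆_ : FinSet → FinSet → Set
A ⊆ B = ∀ {x} → x ∈ A → x ∈ B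

_≐_ : FinSet → FinSet → Set
A ≐ B = A ⊆ B × B ⊆ A

Nonempty : FinSet → Set
Nonempty A = ∃ λ x → x ∈ A

Disjoint : FinSet → FinSet → Set
Disjoint A B = ∀ {x} → x ∈ A → x ∈ B → ⊥

Coll : (ℓ : Level) → Set (lsuc ℓ)
Coll ℓ = FinSet → Set ℓ

-- Boolean sublattice: contains ∅ and closed under (binary, hence finite)
-- unions.  `resp` says the predicate really describes a set of finite sets
-- (it does not depend on the list representation).
record IsBoolSublattice {ℓ : Level} (S : Coll ℓ) : Set ℓ where
  field
    resp  : ∀ {A B} → A ≐ B → S A → S B
    empty : S []
    union : ∀ {A B} → S A → S B → S (A ++ B)

⟨_⟩ : {ℓ : Level} → Coll ℓ → Coll (lsuc ℓ)
⟨_⟩ {ℓ} T X = (S : Coll ℓ) → IsBoolSublattice S → (∀ {Y} → T Y → S Y) → S X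

Quark : {ℓ : Level} → Coll ℓ → FinSet → Set ℓ
Quark S A =
  S A × Nonempty A ×
  ¬ (Σ FinSet λ B → S B × Nonempty B × B ⊆ A × ¬ (A ⊆ B))

Isolated : {ℓ : Level} → Coll ℓ → FinSet → Set ℓ
Isolated S A = Quark S A × (∀ B → Quark S B → ¬ (B ≐ A) → Disjoint A B)

_∈ₛ_ : FinSet → List FinSet → Set
A ∈ₛ z = Any (A ≐_) z

_⊑_ : List FinSet → List FinSet → Set
z' ⊑ z = ∀ {A} → A ∈ₛ z' → A ∈ₛ z

SameColl : List FinSet → List FinSet → Set
SameColl z₁ z₂ = z₁ ⊑ z₂ × z₂ ⊑ z₁

-- factorization of X in S: a finite set z of quarks (list without
-- repetitions, so length z = |z|) with ⋃ z = X and ⋃ z' ⊊ X for every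
-- proper subset z' ⊊ z.
Factorization : {ℓ : Level} → Coll ℓ → FinSet → List FinSet → Set ℓ
Factorization S X z =
  All (Quark S) z ×
  AllPairs (λ A B → ¬ (A ≐ B)) z ×
  concat z ≐ X ×
  (∀ z' → z' ⊑ z → ¬ (z ⊑ z') → concat z' ⊆ X × ¬ (X ⊆ concat z'))

IsLFS : {ℓ : Level} → Coll ℓ → Set ℓ
IsLFS S =
  ∀ X → S X → Nonempty X → ∀ z₁ z₂ →
  Factorization S X z₁ → Factorization S X z₂ →
  ¬ SameColl z₁ z₂ → length z₁ ≢ length z₂

-- Every quark of ⟨𝒜(S) ∖ 𝒜_I(S)⟩ is a quark of S, so its factorizations are
-- factorizations in S; this gives LFS S ⇒ LFS ⟨𝒜(S) ∖ 𝒜_I(S)⟩.  Conversely, an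
-- isolated quark contained in X belongs to every factorization of X and meets no
-- other member of it.  Given two distinct factorizations of X of the same size,
-- strip from both the members that occur in both and are disjoint from all other
-- members.  The same number of members is removed from each, the remainders
-- consist of non-isolated quarks, have the same union Y, and are still distinct,
-- so they are distinct factorizations of Y in ⟨𝒜(S) ∖ 𝒜_I(S)⟩ of equal size.
-- Isolatedness itself is not decidable, which is why the stripped members are
-- singled out by this decidable property instead.

module Submission where

open import Defs
open import Level using (0ℓ)
open import Function.Base using (_∘_; id)
open import Function.Bundles using (_⇔_; mk⇔)
open import Data.Empty using (⊥-elim)
open import Data.Nat using (suc; _+_; _≤_; z≤n; s≤s)
open import Data.Nat.Properties using (_≟_; ≤-antisym; +-cancelˡ-≡; +-suc)
open import Data.Product using (_×_; _,_; proj₁; proj₂; Σ; swap; map₂)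
open import Data.Sum using (_⊎_; inj₁; inj₂)
open import Data.List using (List; []; _∷_; _++_; concat; length; filter)
open import Data.List.Properties using (length-removeAt′; ++-identityʳ; concat-++)
open import Data.List.Membership.Propositional using (_∈_; find; lose)
open import Data.List.Membership.Propositional.Properties
  using (∈-concat⁺′; ∈-concat⁻′; ∈-filter⁺; ∈-filter⁻)
open import Data.List.Membership.DecPropositional _≟_ using (_∈?_)
open import Data.List.Relation.Binary.Subset.DecPropositional _≟_ using (_⊆?_)
open import Data.List.Relation.Binary.Subset.Propositional.Properties
  using (++⁺; concat⁺; xs⊆xs++ys; xs⊆ys++xs)
open import Data.List.Relation.Unary.All as All using (All; []; _∷_)
open import Data.List.Relation.Unary.Any as Any using (here; there)
open import Data.List.Relation.Unary.AllPairs using (AllPairs; []; _∷_)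
open import Data.List.Relation.Unary.Any.Properties using (++⁻)
import Data.List.Relation.Unary.AllPairs.Properties as AllPairs
import Data.List.Relation.Unary.All.Properties as All
import Data.List.Membership.Setoid as SetoidMembership
import Data.List.Membership.Setoid.Properties as SetoidMembershipₚ
import Data.List.Relation.Binary.Subset.Setoid as SetoidSubset
import Data.List.Relation.Binary.Subset.Setoid.Properties as SetoidSubsetₚ
import Data.List.Relation.Unary.Unique.Setoid as SetoidUnique
open import Relation.Nullary using (¬_; Dec; yes; no; ¬?)
open import Relation.Nullary.Decidable using (_×-dec_; _→-dec_; map′; decidable-stable)
open import Relation.Unary using (Pred; Decidable)
open import Relation.Unary.Properties using (∁?)
open import Relation.Binary.Bundles using (Setoid)
open import Relation.Binary.Structures using (IsEquivalence)
open import Relation.Binary.PropositionalEquality as ≡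
  using (_≡_; refl; cong; subst; module ≡-Reasoning)

length-filter+filter-∁ : ∀ {a p} {A : Set a} {P : Pred A p} (P? : Decidable P) xs →
  length xs ≡ length (filter P? xs) + length (filter (∁? P?) xs)
length-filter+filter-∁ P? [] = refl
length-filter+filter-∁ P? (x ∷ xs) with P? x
... | yes _ = cong suc (length-filter+filter-∁ P? xs)
... | no _  = ≡.trans (cong suc (length-filter+filter-∁ P? xs)) (≡.sym (+-suc _ _))

module _ {c ℓ} (S : Setoid c ℓ) where
  open Setoid S using (_≈_; sym; trans) renaming (refl to ≈-refl)
  open SetoidMembership S using (_─_) renaming (_∈_ to _∈ˢ_)
  open SetoidMembershipₚ using (∈-resp-≈; All[≉]⇒∉)
  open SetoidSubset S using () renaming (_⊆_ to _⊆ˢ_)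
  open SetoidUnique S using (Unique)

  ∈-─⁺ : ∀ {x y ys} (x∈ys : x ∈ˢ ys) → ¬ x ≈ y → y ∈ˢ ys → y ∈ˢ ys ─ x∈ys
  ∈-─⁺ (here x≈z) x≉y (here y≈z) = ⊥-elim (x≉y (trans x≈z (sym y≈z)))
  ∈-─⁺ (here _)   _   (there y∈) = y∈
  ∈-─⁺ (there _)  _   (here y≈z) = here y≈z
  ∈-─⁺ (there x∈) x≉y (there y∈) = there (∈-─⁺ x∈ x≉y y∈)

  Unique-⊆⇒length≤ : ∀ {xs ys} → Unique xs → xs ⊆ˢ ys → length xs ≤ length ys
  Unique-⊆⇒length≤ [] _ = z≤n
  Unique-⊆⇒length≤ {x ∷ xs} {ys} (x∉xs ∷ xs!) x∷xs⊆ys =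
    subst (suc (length xs) ≤_) (≡.sym (length-removeAt′ ys _))
          (s≤s (Unique-⊆⇒length≤ xs! xs⊆ys─x))
    where
    x∈ys : x ∈ˢ ys
    x∈ys = x∷xs⊆ys (here ≈-refl)

    xs⊆ys─x : xs ⊆ˢ ys ─ x∈ys
    xs⊆ys─x y∈xs = ∈-─⁺ x∈ys
      (λ x≈y → All[≉]⇒∉ S x∉xs (∈-resp-≈ S (sym x≈y) y∈xs)) (x∷xs⊆ys (there y∈xs))

≐-isEquivalence : IsEquivalence _≐_
≐-isEquivalence = record
  { refl  = id , id
  ; sym   = swap
  ; trans = λ (f , g) (h , k) → h ∘ f , g ∘ k
  }

≐-setoid : Setoid 0ℓ 0ℓ
≐-setoid = record { isEquivalence = ≐-isEquivalence }

open Setoid ≐-setoid using ()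
  renaming (refl to ≐-refl; reflexive to ≐-reflexive; sym to ≐-sym; trans to ≐-trans)

∈ₛ-resp-≐ : ∀ {A B z} → A ≐ B → A ∈ₛ z → B ∈ₛ z
∈ₛ-resp-≐ = SetoidMembershipₚ.∈-resp-≈ ≐-setoid

_≐?_ : ∀ A B → Dec (A ≐ B)
A ≐? B = A ⊆? B ×-dec B ⊆? A

_∈ₛ?_ : ∀ A z → Dec (A ∈ₛ z)
A ∈ₛ? z = Any.any? (A ≐?_) z

disjoint? : ∀ A B → Dec (Disjoint A B)
disjoint? A B =
  map′ (λ h → All.lookup h) All.tabulate (All.all? (λ x → ¬? (x ∈? B)) A)

nonempty? : ∀ A → Dec (Nonempty A)
nonempty? []      = no λ ()
nonempty? (x ∷ _) = yes (x , here refl)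

∈⇒⊆concat : ∀ {A z} → A ∈ z → A ⊆ concat z
∈⇒⊆concat A∈z x∈A = ∈-concat⁺′ x∈A A∈z

concat-⊑ : ∀ {z z'} → z ⊑ z' → concat z ⊆ concat z'
concat-⊑ {z} z⊑z' x∈z with ∈-concat⁻′ z x∈z
... | A , x∈A , A∈z with find (z⊑z' (lose A∈z ≐-refl))
... | B , B∈z' , A⊆B , _ = ∈-concat⁺′ (A⊆B x∈A) B∈z'

concat-filter⁻ : ∀ {P : Pred FinSet 0ℓ} (P? : Decidable P) w {x} → x ∈ concat w →
  x ∈ concat (filter P? w) ⊎ x ∈ concat (filter (∁? P?) w)
concat-filter⁻ P? w x∈w with ∈-concat⁻′ w x∈w
... | A , x∈A , A∈w with P? A
... | yes PA  = inj₁ (∈-concat⁺′ x∈A (∈-filter⁺ P? A∈w PA))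
... | no ¬PA  = inj₂ (∈-concat⁺′ x∈A (∈-filter⁺ (∁? P?) A∈w ¬PA))

⊑-of-empty-concat : ∀ {u u'} → All Nonempty u → ¬ Nonempty (concat u) → u ⊑ u'
⊑-of-empty-concat ne empty A∈u with find A∈u
... | B , B∈u , _ with All.lookup ne B∈u
... | x , x∈B = ⊥-elim (empty (x , ∈-concat⁺′ x∈B B∈u))

concat-++-≐ : ∀ (Ls Ms : List FinSet) {A B : FinSet} →
  concat Ls ≐ A → concat Ms ≐ B → concat (Ls ++ Ms) ≐ (A ++ B)
concat-++-≐ Ls Ms (f , g) (h , k) rewrite ≡.sym (concat-++ Ls Ms) = ++⁺ f h , ++⁺ g k

module _ {ℓ} {S : Coll ℓ} where

  Quark-resp-≐ : (∀ {A B} → A ≐ B → S A → S B) → ∀ {A B} → A ≐ B → Quark S A → Quark S B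
  Quark-resp-≐ resp (f , g) (SA , (x , x∈A) , minimal) =
    resp (f , g) SA , (x , f x∈A) ,
    λ (C , SC , neC , C⊆B , B⊈C) → minimal (C , SC , neC , g ∘ C⊆B , λ A⊆C → B⊈C (A⊆C ∘ g))

  Quark-restrict : ∀ {ℓ'} {S' : Coll ℓ'} → (∀ {X} → S' X → S X) →
    ∀ {A} → S' A → Quark S A → Quark S' A
  Quark-restrict S'⊆S S'A (_ , ne , minimal) =
    S'A , ne , λ (B , S'B , rest) → minimal (B , S'⊆S S'B , rest)

  Quark-minimal : ∀ {A B} → Quark S A → S B → Nonempty B → B ⊆ A → A ⊆ B
  Quark-minimal {A} {B} (_ , _ , minimal) SB neB B⊆A =
    decidable-stable (A ⊆? B) (λ A⊈B → minimal (B , SB , neB , B⊆A , A⊈B))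

  concat-closed : IsBoolSublattice S → ∀ {Ls} → All S Ls → S (concat Ls)
  concat-closed bs []         = IsBoolSublattice.empty bs
  concat-closed bs (SA ∷ SLs) = IsBoolSublattice.union bs SA (concat-closed bs SLs)

module _ {ℓ} {T : Coll ℓ} where

  ⟨⟩-least : ∀ {S : Coll ℓ} → IsBoolSublattice S → (∀ {Y} → T Y → S Y) →
    ∀ {X} → ⟨ T ⟩ X → S X
  ⟨⟩-least bs T⊆S ⟨T⟩X = ⟨T⟩X _ bs T⊆S

  ⟨⟩-base : ∀ {A} → T A → ⟨ T ⟩ A
  ⟨⟩-base TA _ _ T⊆S = T⊆S TA

  ⟨⟩-isBoolSublattice : IsBoolSublattice ⟨ T ⟩
  ⟨⟩-isBoolSublattice = record
    { resp  = λ e ⟨T⟩A S bs T⊆S → IsBoolSublattice.resp bs e (⟨T⟩A S bs T⊆S)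
    ; empty = λ S bs _ → IsBoolSublattice.empty bs
    ; union = λ ⟨T⟩A ⟨T⟩B S bs T⊆S →
        IsBoolSublattice.union bs (⟨T⟩A S bs T⊆S) (⟨T⟩B S bs T⊆S)
    }

  UnionOf : Coll ℓ
  UnionOf X = Σ (List FinSet) λ Ls → All T Ls × concat Ls ≐ X

  UnionOf-isBoolSublattice : IsBoolSublattice UnionOf
  UnionOf-isBoolSublattice = record
    { resp  = λ e (Ls , TLs , e') → Ls , TLs , ≐-trans e' e
    ; empty = [] , [] , ≐-refl
    ; union = λ (Ls , TLs , e) (Ms , TMs , e') →
        Ls ++ Ms , All.++⁺ TLs TMs , concat-++-≐ Ls Ms e e'
    }

  ⟨⟩⇒UnionOf : ∀ {X} → ⟨ T ⟩ X → UnionOf X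
  ⟨⟩⇒UnionOf = ⟨⟩-least UnionOf-isBoolSublattice
    (λ {A} TA → A ∷ [] , TA ∷ [] , ≐-reflexive (++-identityʳ A))

  Quark-⟨⟩⇒Quark : ∀ {S : Coll ℓ} → IsBoolSublattice S → (∀ {A} → T A → Quark S A) →
    ∀ {A} → Quark ⟨ T ⟩ A → Quark S A
  Quark-⟨⟩⇒Quark bs T⇒Quark {A} qA@(⟨T⟩A , (x , x∈A) , _) with ⟨⟩⇒UnionOf ⟨T⟩A
  ... | Ls , TLs , Ls⊆A , A⊆Ls with ∈-concat⁻′ Ls (A⊆Ls x∈A)
  ... | Q , x∈Q , Q∈Ls = Quark-resp-≐ (IsBoolSublattice.resp bs)
    (Q⊆A , Quark-minimal qA (⟨⟩-base TQ) (x , x∈Q) Q⊆A) (T⇒Quark TQ)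
    where
    TQ : T Q
    TQ = All.lookup TLs Q∈Ls

    Q⊆A : Q ⊆ A
    Q⊆A = Ls⊆A ∘ ∈⇒⊆concat Q∈Ls

  Quark⇒Quark-⟨⟩ : ∀ {S : Coll ℓ} → IsBoolSublattice S → (∀ {A} → T A → Quark S A) →
    ∀ {A} → T A → Quark ⟨ T ⟩ A
  Quark⇒Quark-⟨⟩ bs T⇒Quark TA =
    Quark-restrict (⟨⟩-least bs (proj₁ ∘ T⇒Quark)) (⟨⟩-base TA) (T⇒Quark TA)

module Factorization {ℓ} {S : Coll ℓ} {X z} (f : Factorization S X z) where

  quarks : All (Quark S) z
  quarks = proj₁ f

  distinct : AllPairs (λ A B → ¬ (A ≐ B)) z
  distinct = proj₁ (proj₂ f)

  covers : concat z ≐ X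
  covers = proj₁ (proj₂ (proj₂ f))

  minimal : ∀ z' → z' ⊑ z → ¬ (z ⊑ z') → concat z' ⊆ X × ¬ (X ⊆ concat z')
  minimal = proj₂ (proj₂ (proj₂ f))

  member-⊆ : ∀ {A} → A ∈ z → A ⊆ X
  member-⊆ A∈z = proj₁ covers ∘ ∈⇒⊆concat A∈z

IsLFS-antitone : ∀ {ℓ ℓ'} {S : Coll ℓ} {S' : Coll ℓ'} →
  (∀ {X} → S' X → S X) → (∀ {A} → Quark S' A → Quark S A) → IsLFS S → IsLFS S'
IsLFS-antitone S'⊆S Quark⇒Quark lfs X S'X neX z₁ z₂
               (q₁ , d₁ , e₁ , m₁) (q₂ , d₂ , e₂ , m₂) =
  lfs X (S'⊆S S'X) neX z₁ z₂
      (All.map Quark⇒Quark q₁ , d₁ , e₁ , m₁) (All.map Quark⇒Quark q₂ , d₂ , e₂ , m₂)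

Separated : FinSet → FinSet → Set
Separated C D = ¬ (D ≐ C) → Disjoint C D

Clear : List FinSet → FinSet → Set
Clear w C = C ∈ₛ w × All (Separated C) w

Clear? : ∀ w C → Dec (Clear w C)
Clear? w C = C ∈ₛ? w ×-dec All.all? (λ D → ¬? (D ≐? C) →-dec disjoint? C D) w

Clear-resp-≐ : ∀ {w A B} → A ≐ B → Clear w A → Clear w B
Clear-resp-≐ A≐B (A∈w , sep) =
  ∈ₛ-resp-≐ A≐B A∈w ,
  All.map (λ sepA D≉B {_} x∈B x∈D → sepA (λ D≐A → D≉B (≐-trans D≐A A≐B)) (proj₂ A≐B x∈B) x∈D) sep

Shared : List FinSet → List FinSet → FinSet → Set
Shared z₁ z₂ C = Clear z₁ C × Clear z₂ C

Shared? : ∀ z₁ z₂ C → Dec (Shared z₁ z₂ C)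
Shared? z₁ z₂ C = Clear? z₁ C ×-dec Clear? z₂ C

Shared-resp-≐ : ∀ {z₁ z₂ A B} → A ≐ B → Shared z₁ z₂ A → Shared z₁ z₂ B
Shared-resp-≐ A≐B (clear₁ , clear₂) = Clear-resp-≐ A≐B clear₁ , Clear-resp-≐ A≐B clear₂

module _ (S : Coll 0ℓ) (S-bool : IsBoolSublattice S) where

  NonIsolatedQuark : Coll 0ℓ
  NonIsolatedQuark A = Quark S A × ¬ Isolated S A

  Isolated⇒Clear : ∀ {A X v} → Isolated S A → A ⊆ X → Factorization S X v → Clear v A
  Isolated⇒Clear {A} {v = v} ((_ , (x , x∈A) , _) , isolated) A⊆X (quarks , _ , (_ , X⊆v) , _) =
    A∈v , All.tabulate (λ D∈v D≉A → isolated _ (All.lookup quarks D∈v) D≉A)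
    where
    A∈v : A ∈ₛ v
    A∈v with ∈-concat⁻′ v (X⊆v (A⊆X x∈A))
    ... | Q , x∈Q , Q∈v with Q ≐? A
    ... | yes Q≐A = lose Q∈v (≐-sym Q≐A)
    ... | no Q≉A  = ⊥-elim (isolated Q (All.lookup quarks Q∈v) Q≉A x∈A x∈Q)

  NonIsolatedQuark⇒Quark-⟨⟩ : ∀ {A} → NonIsolatedQuark A → Quark ⟨ NonIsolatedQuark ⟩ A
  NonIsolatedQuark⇒Quark-⟨⟩ = Quark⇒Quark-⟨⟩ S-bool proj₁

  module Stripping {R : Pred FinSet 0ℓ} (R? : Decidable R)
                   (R-resp-≐ : ∀ {A B} → A ≐ B → R A → R B) where

    stripped remaining : List FinSet → List FinSet
    stripped  = filter R?
    remaining = filter (∁? R?)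

    ∁R-resp-≐ : ∀ {A B} → A ≐ B → ¬ R A → ¬ R B
    ∁R-resp-≐ A≐B ¬RA RB = ¬RA (R-resp-≐ (≐-sym A≐B) RB)

    module Pair {X w v} (fw : Factorization S X w) (fv : Factorization S X v)
             (R⇒∈ₛ : ∀ {C} → R C → C ∈ₛ v)
             (R⇒Separated : ∀ {C} → R C → All (Separated C) w)
             (Isolated⇒R : ∀ {A} → Isolated S A → A ⊆ X → R A) where

      open Factorization fw using (quarks; distinct; minimal; member-⊆)
        renaming (covers to w-covers)
      open Factorization fv using () renaming (covers to v-covers)

      remaining-nonIsolated : All NonIsolatedQuark (remaining w)
      remaining-nonIsolated = All.tabulate λ A∈ →
        let A∈w , ¬RA = ∈-filter⁻ (∁? R?) {xs = w} A∈ in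
        All.lookup quarks A∈w , ¬RA ∘ (λ isolated → Isolated⇒R isolated (member-⊆ A∈w))

      remaining-nonempty : All Nonempty (remaining w)
      remaining-nonempty = All.map (proj₁ ∘ proj₂ ∘ proj₁) remaining-nonIsolated

      remaining-⊆ : concat (remaining w) ⊆ concat (remaining v)
      remaining-⊆ x∈rest with ∈-concat⁻′ (remaining w) x∈rest
      ... | A , x∈A , A∈rest with ∈-filter⁻ (∁? R?) {xs = w} A∈rest
      ... | A∈w , ¬RA
        with concat-filter⁻ R? v (proj₂ v-covers (proj₁ w-covers (∈-concat⁺′ x∈A A∈w)))
      ... | inj₂ x∈rest' = x∈rest'
      ... | inj₁ x∈stripped with ∈-concat⁻′ (stripped v) x∈stripped
      ... | B , x∈B , B∈stripped with ∈-filter⁻ R? {xs = v} B∈stripped | A ≐? B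
      ... | _ , RB | yes A≐B = ⊥-elim (¬RA (R-resp-≐ (≐-sym A≐B) RB))
      ... | _ , RB | no A≉B  = ⊥-elim (All.lookup (R⇒Separated RB) A∈w A≉B x∈B x∈A)

      stripped-⊑ : stripped w ⊑ stripped v
      stripped-⊑ C∈ with SetoidMembershipₚ.∈-filter⁻ ≐-setoid R? R-resp-≐ {xs = w} C∈
      ... | _ , RC = SetoidMembershipₚ.∈-filter⁺ ≐-setoid R? R-resp-≐ (R⇒∈ₛ RC) RC

      remaining-⊑⇒⊑ : remaining w ⊑ remaining v → w ⊑ v
      remaining-⊑⇒⊑ rest⊑ {C} C∈w with R? C
      ... | yes RC = R⇒∈ₛ RC
      ... | no ¬RC = SetoidSubsetₚ.filter-⊆ ≐-setoid (∁? R?) v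
        (rest⊑ (SetoidMembershipₚ.∈-filter⁺ ≐-setoid (∁? R?) ∁R-resp-≐ C∈w ¬RC))

      ++-stripped-⊑ : ∀ {z} → z ⊑ remaining w → (z ++ stripped w) ⊑ w
      ++-stripped-⊑ {z} z⊑rest C∈ with ++⁻ z C∈
      ... | inj₁ C∈z        = SetoidSubsetₚ.filter-⊆ ≐-setoid (∁? R?) w (z⊑rest C∈z)
      ... | inj₂ C∈stripped = SetoidSubsetₚ.filter-⊆ ≐-setoid R? w C∈stripped

      ⊑-++-stripped⇒⊑ : ∀ {z} → w ⊑ (z ++ stripped w) → remaining w ⊑ z
      ⊑-++-stripped⇒⊑ {z} w⊑ C∈rest
        with SetoidMembershipₚ.∈-filter⁻ ≐-setoid (∁? R?) ∁R-resp-≐ {xs = w} C∈rest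
      ... | C∈w , ¬RC with ++⁻ z (w⊑ C∈w)
      ... | inj₁ C∈z        = C∈z
      ... | inj₂ C∈stripped =
        ⊥-elim (¬RC (proj₂ (SetoidMembershipₚ.∈-filter⁻ ≐-setoid R? R-resp-≐ {xs = w} C∈stripped)))

      ⊆-++-stripped : ∀ {z} → concat (remaining w) ⊆ concat z → X ⊆ concat (z ++ stripped w)
      ⊆-++-stripped {z} rest⊆z x∈X with concat-filter⁻ R? w (proj₂ w-covers x∈X)
      ... | inj₁ x∈stripped = concat⁺ (xs⊆ys++xs (stripped w) z) x∈stripped
      ... | inj₂ x∈rest     = concat⁺ (xs⊆xs++ys z (stripped w)) (rest⊆z x∈rest)

      remaining-factorization : ∀ {Y} → concat (remaining w) ≐ Y →
        Factorization ⟨ NonIsolatedQuark ⟩ Y (remaining w)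
      remaining-factorization (rest⊆Y , Y⊆rest) =
        All.map NonIsolatedQuark⇒Quark-⟨⟩ remaining-nonIsolated ,
        AllPairs.filter⁺ (∁? R?) distinct , (rest⊆Y , Y⊆rest) ,
        λ z z⊑rest rest⋢z →
          rest⊆Y ∘ concat-⊑ z⊑rest ,
          λ Y⊆z → proj₂ (minimal (z ++ stripped w) (++-stripped-⊑ z⊑rest)
                                 (rest⋢z ∘ ⊑-++-stripped⇒⊑))
                        (⊆-++-stripped {z} (Y⊆z ∘ rest⊆Y))

  IsLFS-⟨NonIsolatedQuark⟩⇒IsLFS : IsLFS ⟨ NonIsolatedQuark ⟩ → IsLFS S
  IsLFS-⟨NonIsolatedQuark⟩⇒IsLFS lfs X _ _ z₁ z₂ f₁ f₂ z₁≉z₂ |z₁|≡|z₂| =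
    lfs (concat (remaining z₁))
        (concat-closed ⟨⟩-isBoolSublattice (All.map ⟨⟩-base P₁.remaining-nonIsolated))
        nonempty-union (remaining z₁) (remaining z₂)
        (P₁.remaining-factorization ≐-refl)
        (P₂.remaining-factorization (P₂.remaining-⊆ , P₁.remaining-⊆))
        remaining-distinct |remaining|≡
    where
    open Stripping (Shared? z₁ z₂) Shared-resp-≐

    isolated-shared : ∀ {A} → Isolated S A → A ⊆ X → Shared z₁ z₂ A
    isolated-shared isolated A⊆X = Isolated⇒Clear isolated A⊆X f₁ , Isolated⇒Clear isolated A⊆X f₂

    module P₁ = Pair f₁ f₂ (proj₁ ∘ proj₂) (proj₂ ∘ proj₁) isolated-shared
    module P₂ = Pair f₂ f₁ (proj₁ ∘ proj₁) (proj₂ ∘ proj₂) isolated-shared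

    remaining-distinct : ¬ SameColl (remaining z₁) (remaining z₂)
    remaining-distinct (rest₁⊑rest₂ , rest₂⊑rest₁) =
      z₁≉z₂ (P₁.remaining-⊑⇒⊑ rest₁⊑rest₂ , P₂.remaining-⊑⇒⊑ rest₂⊑rest₁)

    nonempty-union : Nonempty (concat (remaining z₁))
    nonempty-union = decidable-stable (nonempty? _) λ empty →
      remaining-distinct
        ( ⊑-of-empty-concat P₁.remaining-nonempty empty
        , ⊑-of-empty-concat P₂.remaining-nonempty (empty ∘ map₂ P₂.remaining-⊆))

    |stripped|≡ : length (stripped z₁) ≡ length (stripped z₂)
    |stripped|≡ = ≤-antisym
      (Unique-⊆⇒length≤ ≐-setoid (AllPairs.filter⁺ _ (Factorization.distinct f₁)) P₁.stripped-⊑)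
      (Unique-⊆⇒length≤ ≐-setoid (AllPairs.filter⁺ _ (Factorization.distinct f₂)) P₂.stripped-⊑)

    |remaining|≡ : length (remaining z₁) ≡ length (remaining z₂)
    |remaining|≡ = +-cancelˡ-≡ (length (stripped z₁)) _ _ (begin
      length (stripped z₁) + length (remaining z₁) ≡⟨ ≡.sym (length-filter+filter-∁ _ z₁) ⟩
      length z₁                                     ≡⟨ |z₁|≡|z₂| ⟩
      length z₂                                     ≡⟨ length-filter+filter-∁ _ z₂ ⟩
      length (stripped z₂) + length (remaining z₂) ≡⟨ cong (_+ length (remaining z₂)) (≡.sym |stripped|≡) ⟩
      length (stripped z₁) + length (remaining z₂) ∎)
      where open ≡-Reasoning

proposition7p1 : (S : Coll 0ℓ) → IsBoolSublattice S →
    (IsLFS S ⇔ IsLFS ⟨ (λ A → Quark S A × ¬ Isolated S A) ⟩)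
proposition7p1 S S-bool = mk⇔
  (IsLFS-antitone (⟨⟩-least S-bool (proj₁ ∘ proj₁)) (Quark-⟨⟩⇒Quark S-bool proj₁))
  (IsLFS-⟨NonIsolatedQuark⟩⇒IsLFS S S-bool)
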